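{- Let $k\ge 3$ be an integer. Consider the two-player game played on $k$ heaps of tokens (each heap containing finitely many tokens), in which the players alternate moves, a move being either (i) removing a positive number of tokens from each of at least one and at most $k-1$ heaps (possibly emptying them), or (ii) removing the same positive number of tokens from every one of the $k$ heaps; the player making the last move wins. Write a position in standard form $(m_0,\dots,m_{k-1})$ with $0\le m_0\le\dots\le m_{k-1}$, where the $m_i$ are the heap sizes, and let $T_n=\frac12 n(n+1)$ for $n\in\mathbb{Z}_{\ge 0}$. Then the set $\mathcal P$ of $P$-positions of this game is $\mathcal P=\bigcup_{n=0}^{\infty}P_n$, where $$P_n=\Bigl\{(T_n,m_1,\dots,m_{k-1}) : \sum_{i=1}^{k-1}m_i=(k-1)T_n+n,\ T_n\le m_1\le\dots\le m_{k-1}\Bigr\}.$$ That is, the $P$-positions are exactly the positions $(T_n,m_1,\dots,m_{k-1})$ where $(m_1,\dots,m_{k-1})$ ranges over all unordered partitions of $(k-1)T_n+n$ into $k-1$ parts each of size at least $T_n$, for $n\in\mathbb{Z}_{\ge 0}$.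
   Context: A $P$-position is a position from which the previous player (the opponent of the player about to move) can force a win; an $N$-position is one from which the next player (the player about to move) can force a win. $\mathbb{Z}_{\ge 0}$ denotes the nonnegative integers. -}

module Defs where

open import Data.Nat using (ℕ; zero; suc; _+_; _*_; _≤_; _<_; _/_)
open import Data.Fin using (Fin; zero; suc)
open import Data.Product using (Σ; ∃; _×_; _,_)
open import Data.Sum using (_⊎_)
open import Relation.Binary.PropositionalEquality using (_≡_; _≢_)
open import Relation.Nullary using (¬_)
import Data.Nat
import Data.Fin
import Relation.Nullary
open import Function.Bundles using (_↔_; Inverse)

Position : ℕ → Set
Position k = Fin k → ℕ

sumF : ∀ {k} → (Fin k → ℕ) → ℕ
sumF {zero}  f = 0
sumF {suc k} f = f zero + sumF (λ i → f (suc i))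

countDec : ∀ {k} → Position k → Position k → ℕ
countDec {zero}  p q = 0
countDec {suc k} p q = count0 + countDec (λ i → p (suc i)) (λ i → q (suc i))
  where
  count0 : ℕ
  count0 with Data.Nat._<?_ (q zero) (p zero)
  ... | Relation.Nullary.yes _ = 1
  ... | Relation.Nullary.no _  = 0

-- Move type (i): each heap is kept or reduced; between 1 and k-1 heaps
-- strictly reduced (positive number of tokens removed from each of them).
MoveI : ∀ k → Position k → Position k → Set
MoveI k p q = (∀ i → q i ≤ p i) × 1 ≤ countDec p q × suc (countDec p q) ≤ k

MoveII : ∀ k → Position k → Position k → Set
MoveII k p q = Σ ℕ λ t → 1 ≤ t × (∀ i → p i ≡ q i + t)

Move : ∀ k → Position k → Position k → Set
Move k p q = MoveI k p q ⊎ MoveII k p q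

-- P- and N-positions under normal play (last mover wins), defined by
-- the usual mutual recursion (the game is finite since every move
-- strictly decreases the total number of tokens).
mutual
  data IsP (k : ℕ) (p : Position k) : Set where
    allMovesToN : (∀ q → Move k p q → IsN k q) → IsP k p

  data IsN (k : ℕ) (p : Position k) : Set where
    moveToP : (q : Position k) → Move k p q → IsP k q → IsN k p

T : ℕ → ℕ
T n = (n * suc n) / 2

Sorted : ∀ {k} → (Fin k → ℕ) → Set
Sorted {k} m = ∀ (i j : Fin k) → Data.Fin._≤_ i j → m i ≤ m j

-- Membership of a standard-form tuple (m_0,...,m_{k-1}), k = suc j, in P_n:
-- m_0 = T_n, sum_{i≥1} m_i = (k-1) T_n + n, T_n ≤ m_1 ≤ ... ≤ m_{k-1}.
InPn : ∀ j → ℕ → (Fin (suc j) → ℕ) → Set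
InPn j n m = (m zero ≡ T n)
           × (sumF (λ i → m (suc i)) ≡ j * T n + n)
           × (∀ i → T n ≤ m (suc i))
           × (∀ (i i' : Fin j) → Data.Fin._≤_ i i' → m (suc i) ≤ m (suc i'))

InP : ∀ j → Position (suc j) → Set
InP j p = Σ (Fin (suc j) ↔ Fin (suc j)) λ σ →
            Sorted (λ i → p (Inverse.to σ i)) ×
            Σ ℕ λ n → InPn j n (λ i → p (Inverse.to σ i))

-- Let Pₙ be the set of positions whose smallest heap is Tₙ and whose total is k·Tₙ + n (the
-- paper's Pₙ, up to reordering the heaps). Every heap of a position in Pₙ lies in [Tₙ, Tₙ₊₁), so
-- the level n can be read off any single heap. Hence no move joins two positions of ⋃ Pₙ: a
-- type-(i) move leaves some heap untouched, so it keeps the level and with it the total, which it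
-- must change; a type-(ii) move removing t from each heap lowers the minimum by t and the total
-- by k·t, which forces t = 0.
-- Conversely, let a position have minimum μ and total kμ + e. If Tₑ < μ, removing μ − Tₑ from
-- every heap reaches Pₑ. Otherwise Tₙ ≤ μ < Tₙ₊₁ with n ≤ e; if n = e the position is in Pₙ, and
-- if n < e a type-(i) move reaches Pₙ by keeping one heap of size at most Tₙ + n untouched,
-- lowering a different one to Tₙ, and removing the rest of the excess elsewhere. With k ≥ 3 pick
-- heaps r, z besides a minimal one: if r ≤ Tₙ + n keep r and lower the minimal heap; otherwise
-- keep the minimal heap and lower z, the large heap r leaving enough tokens.
-- Since every move removes tokens, ⋃ Pₙ is exactly the set of P-positions.

module Submission where

open import Defs
open import Data.Nat using (ℕ; zero; suc; _+_; _*_; _∸_; _/_; _≤_; _<_; _≤′_; ≤′-refl; ≤′-step; z≤n; s≤s; z<s; _≤?_; _<?_)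
open import Data.Nat.Properties
open import Data.Nat.DivMod using (+-distrib-/-∣ʳ; m*n/n≡m)
open import Data.Nat.Divisibility using (divides)
open import Data.Nat.Induction using (<-wellFounded)
open import Data.Nat.Tactic.RingSolver using (solve-∀)
open import Data.Fin using (Fin; zero; suc) renaming (_≟_ to _≟ᶠ_)
open import Data.Fin.Properties using (¬∀⟶∃¬)
open import Data.Fin.Permutation as Perm using (Permutation′; _⟨$⟩ʳ_; _⟨$⟩ˡ_; transpose; lift₀; _∘ₚ_)
open import Data.Vec.Functional using (updateAt)
open import Data.Vec.Functional.Properties using (updateAt-updates; updateAt-minimal)
open import Data.Product using (∃-syntax; Σ-syntax; _×_; _,_)
open import Data.Sum using (_⊎_; inj₁; inj₂)
open import Data.Empty using (⊥-elim)
open import Function using (const; case_of_)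
open import Function.Bundles using (_⇔_; mk⇔)
open import Function.Construct.Composition using (_⇔-∘_)
open import Induction.WellFounded using (Acc; acc)
open import Relation.Binary.PropositionalEquality
open import Relation.Nullary using (¬_; yes; no)
import Algebra.Properties.CommutativeMonoid.Sum as MonoidSum

T-suc : ∀ n → T (suc n) ≡ T n + suc n
T-suc n = begin
  suc n * suc (suc n) / 2       ≡⟨ cong (_/ 2) (expand n) ⟩
  (n * suc n + suc n * 2) / 2   ≡⟨ +-distrib-/-∣ʳ (n * suc n) (divides (suc n) refl) ⟩
  T n + suc n * 2 / 2           ≡⟨ cong (T n +_) (m*n/n≡m (suc n) 2) ⟩
  T n + suc n                   ∎
  where
  open ≡-Reasoning
  expand : ∀ n → suc n * suc (suc n) ≡ n * suc n + suc n * 2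
  expand = solve-∀

T-<-suc : ∀ n → T n < T (suc n)
T-<-suc n = subst (T n <_) (sym (T-suc n)) (m<m+n (T n) z<s)

T-mono-≤ : ∀ {a b} → a ≤ b → T a ≤ T b
T-mono-≤ a≤b = mono (≤⇒≤′ a≤b)
  where
  mono : ∀ {a b} → a ≤′ b → T a ≤ T b
  mono ≤′-refl                    = ≤-refl
  mono {b = suc b} (≤′-step a≤′b) = ≤-trans (mono a≤′b) (<⇒≤ (T-<-suc b))

T-mono-< : ∀ {a b} → a < b → T a < T b
T-mono-< {a} a<b = <-≤-trans (T-<-suc a) (T-mono-≤ a<b)

T-cancel-≤ : ∀ {a b} → T a ≤ T b → a ≤ b
T-cancel-≤ Ta≤Tb = ≮⇒≥ (λ b<a → <⇒≱ (T-mono-< b<a) Ta≤Tb)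

T-cancel-< : ∀ {a b} → T a < T b → a < b
T-cancel-< Ta<Tb = ≰⇒> (λ b≤a → <⇒≱ Ta<Tb (T-mono-≤ b≤a))

T-floor : ∀ x → ∃[ n ] T n ≤ x × x < T (suc n)
T-floor zero = 0 , z≤n , z<s
T-floor (suc x) with T-floor x
... | n , Tn≤x , x<T[1+n] with suc x <? T (suc n)
...   | yes 1+x<T[1+n] = n , m≤n⇒m≤1+n Tn≤x , 1+x<T[1+n]
...   | no  1+x≮T[1+n] = suc n , ≮⇒≥ 1+x≮T[1+n] , ≤-<-trans x<T[1+n] (T-<-suc (suc n))

T-floor-unique : ∀ {x m n} → T m ≤ x → x < T (suc m) → T n ≤ x → x < T (suc n) → m ≡ n
T-floor-unique Tm≤x x<T[1+m] Tn≤x x<T[1+n] =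
  ≤-antisym (≤-pred (T-cancel-< (≤-<-trans Tm≤x x<T[1+n])))
            (≤-pred (T-cancel-< (≤-<-trans Tn≤x x<T[1+m])))

sumF-cong : ∀ {k} {f g : Fin k → ℕ} → (∀ i → f i ≡ g i) → sumF f ≡ sumF g
sumF-cong {zero}  f≡g = refl
sumF-cong {suc k} f≡g = cong₂ _+_ (f≡g zero) (sumF-cong (λ i → f≡g (suc i)))

sumF-mono : ∀ {k} {f g : Fin k → ℕ} → (∀ i → f i ≤ g i) → sumF f ≤ sumF g
sumF-mono {zero}  f≤g = z≤n
sumF-mono {suc k} f≤g = +-mono-≤ (f≤g zero) (sumF-mono (λ i → f≤g (suc i)))

sumF-const : ∀ k c → sumF {k} (const c) ≡ k * c
sumF-const zero    c = refl
sumF-const (suc k) c = cong (c +_) (sumF-const k c)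

sumF-+-const : ∀ {k} (f : Fin k → ℕ) c → sumF (λ i → f i + c) ≡ sumF f + k * c
sumF-+-const {zero}  f c = refl
sumF-+-const {suc k} f c = begin
  f zero + c + sumF (λ i → f (suc i) + c)         ≡⟨ cong (f zero + c +_) (sumF-+-const (λ i → f (suc i)) c) ⟩
  f zero + c + (sumF (λ i → f (suc i)) + k * c)   ≡⟨ shuffle (f zero) c (sumF (λ i → f (suc i))) (k * c) ⟩
  f zero + sumF (λ i → f (suc i)) + (c + k * c)   ∎
  where
  open ≡-Reasoning
  shuffle : ∀ a b c d → a + b + (c + d) ≡ a + c + (b + d)
  shuffle = solve-∀

sumF-updateAt : ∀ {k} (f : Fin k → ℕ) i v → sumF (updateAt f i (const v)) + f i ≡ sumF f + v
sumF-updateAt f zero    v = shuffle v (sumF (λ i → f (suc i))) (f zero)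
  where
  shuffle : ∀ a b c → a + b + c ≡ c + b + a
  shuffle = solve-∀
sumF-updateAt f (suc i) v = begin
  f zero + sumF (updateAt (λ i → f (suc i)) i (const v)) + f (suc i)   ≡⟨ +-assoc (f zero) _ _ ⟩
  f zero + (sumF (updateAt (λ i → f (suc i)) i (const v)) + f (suc i)) ≡⟨ cong (f zero +_) (sumF-updateAt (λ i → f (suc i)) i v) ⟩
  f zero + (sumF (λ i → f (suc i)) + v)                                ≡⟨ +-assoc (f zero) _ v ⟨
  f zero + sumF (λ i → f (suc i)) + v                                  ∎
  where open ≡-Reasoning

updateAt-elim : ∀ {k} (P : Fin k → ℕ → Set) (f : Fin k → ℕ) r v →
                P r v → (∀ i → i ≢ r → P i (f i)) → ∀ i → P i (updateAt f r (const v) i)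
updateAt-elim P f r v Prv Pf i with i ≟ᶠ r
... | yes refl = subst (P i) (sym (updateAt-updates i f)) Prv
... | no  i≢r  = subst (P i) (sym (updateAt-minimal i r f i≢r)) (Pf i i≢r)

updateAt-≥ : ∀ {k c} (f : Fin k → ℕ) r {v} → (∀ i → c ≤ f i) → c ≤ v → ∀ i → c ≤ updateAt f r (const v) i
updateAt-≥ {c = c} f r {v} c≤f c≤v = updateAt-elim (λ _ x → c ≤ x) f r v c≤v (λ i _ → c≤f i)

sumF-lower-bound : ∀ {k c} (f : Fin k → ℕ) → (∀ i → c ≤ f i) → k * c ≤ sumF f
sumF-lower-bound {k} {c} f c≤f = subst (_≤ sumF f) (sumF-const k c) (sumF-mono c≤f)

sumF-lower-bound-at : ∀ {j c} (f : Fin (suc j) → ℕ) → (∀ i → c ≤ f i) → ∀ r → f r + j * c ≤ sumF f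
sumF-lower-bound-at {j} {c} f c≤f r = +-cancelʳ-≤ c _ _ (begin
  f r + j * c + c                      ≡⟨ shuffle (f r) j c ⟩
  suc j * c + f r                      ≤⟨ +-monoˡ-≤ (f r) (sumF-lower-bound _ (updateAt-≥ f r c≤f ≤-refl)) ⟩
  sumF (updateAt f r (const c)) + f r  ≡⟨ sumF-updateAt f r c ⟩
  sumF f + c                           ∎)
  where
  open ≤-Reasoning
  shuffle : ∀ x j c → x + j * c + c ≡ suc j * c + x
  shuffle = solve-∀

sumF-<⇒∃< : ∀ {k} {f g : Fin k → ℕ} → sumF f < sumF g → ∃[ i ] f i < g i
sumF-<⇒∃< {k} {f} {g} Σf<Σg with ¬∀⟶∃¬ k (λ i → g i ≤ f i) (λ i → g i ≤? f i)
                                        (λ g≤f → <⇒≱ Σf<Σg (sumF-mono g≤f))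
... | i , g≰f = i , ≰⇒> g≰f

sumF-between : ∀ {k} (b c : Fin k → ℕ) → (∀ i → b i ≤ c i) → ∀ {s} → sumF b ≤ s → s ≤ sumF c →
               ∃[ a ] (∀ i → b i ≤ a i) × (∀ i → a i ≤ c i) × sumF a ≡ s
sumF-between {zero}  b c b≤c Σb≤s s≤Σc = const 0 , (λ ()) , (λ ()) , sym (n≤0⇒n≡0 s≤Σc)
sumF-between {suc k} b c b≤c {s} Σb≤s s≤Σc with sumF (λ i → b (suc i)) + c zero ≤? s
... | yes B+c₀≤s =
  let a′ , b≤a′ , a′≤c , Σa′≡s∸c₀ =
        sumF-between (λ i → b (suc i)) (λ i → c (suc i)) (λ i → b≤c (suc i))
                     (m+n≤o⇒m≤o∸n _ B+c₀≤s) (m≤n+o⇒m∸n≤o s (c zero) s≤Σc)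
  in (λ { zero → c zero ; (suc i) → a′ i })
   , (λ { zero → b≤c zero ; (suc i) → b≤a′ i })
   , (λ { zero → ≤-refl ; (suc i) → a′≤c i })
   , trans (cong (c zero +_) Σa′≡s∸c₀) (m+[n∸m]≡n (m+n≤o⇒n≤o (sumF (λ i → b (suc i))) B+c₀≤s))
... | no B+c₀≰s =
  let B = sumF (λ i → b (suc i)) in
    (λ { zero → s ∸ B ; (suc i) → b (suc i) })
  , (λ { zero → m+n≤o⇒m≤o∸n (b zero) Σb≤s ; (suc i) → ≤-refl })
  , (λ { zero → m≤n+o⇒m∸n≤o s B (<⇒≤ (≰⇒> B+c₀≰s)) ; (suc i) → b≤c (suc i) })
  , m∸n+n≡m (m+n≤o⇒n≤o (b zero) Σb≤s)

sumF-shift : ∀ {k} {p : Fin k → ℕ} q {t} → (∀ i → p i ≡ q i + t) → sumF p ≡ sumF q + k * t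
sumF-shift q {t} p≡q+t = trans (sumF-cong p≡q+t) (sumF-+-const q t)

countDec-≤ : ∀ {k} (p q : Position k) → countDec p q ≤ k
countDec-≤ {zero}  p q = z≤n
countDec-≤ {suc k} p q with q zero <? p zero
... | yes _ = s≤s (countDec-≤ (λ i → p (suc i)) (λ i → q (suc i)))
... | no  _ = m≤n⇒m≤1+n (countDec-≤ (λ i → p (suc i)) (λ i → q (suc i)))

countDec-pos⇒sumF-< : ∀ {k} {p q : Position k} → (∀ i → q i ≤ p i) → 1 ≤ countDec p q → sumF q < sumF p
countDec-pos⇒sumF-< {suc k} {p} {q} q≤p 1≤count with q zero <? p zero
... | yes q₀<p₀ = +-mono-<-≤ q₀<p₀ (sumF-mono (λ i → q≤p (suc i)))
... | no  _     = +-mono-≤-< (q≤p zero) (countDec-pos⇒sumF-< (λ i → q≤p (suc i)) 1≤count)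

<⇒countDec-pos : ∀ {k} (p q : Position k) i → q i < p i → 1 ≤ countDec p q
<⇒countDec-pos {suc k} p q i qᵢ<pᵢ with q zero <? p zero | i
... | yes _     | _     = s≤s z≤n
... | no  q₀≮p₀ | zero  = ⊥-elim (q₀≮p₀ qᵢ<pᵢ)
... | no  _     | suc i = <⇒countDec-pos (λ i → p (suc i)) (λ i → q (suc i)) i qᵢ<pᵢ

≮⇒countDec-< : ∀ {k} (p q : Position k) u → ¬ q u < p u → countDec p q < k
≮⇒countDec-< {suc k} p q u qᵤ≮pᵤ with q zero <? p zero | u
... | yes q₀<p₀ | zero  = ⊥-elim (qᵤ≮pᵤ q₀<p₀)
... | no  _     | zero  = s≤s (countDec-≤ (λ i → p (suc i)) (λ i → q (suc i)))
... | yes _     | suc u = s≤s (≮⇒countDec-< (λ i → p (suc i)) (λ i → q (suc i)) u qᵤ≮pᵤ)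
... | no  _     | suc u = m≤n⇒m≤1+n (≮⇒countDec-< (λ i → p (suc i)) (λ i → q (suc i)) u qᵤ≮pᵤ)

countDec-<⇒∃≮ : ∀ {k} (p q : Position k) → countDec p q < k → ∃[ u ] ¬ q u < p u
countDec-<⇒∃≮ {suc k} p q count<k with q zero <? p zero
... | no  q₀≮p₀ = zero , q₀≮p₀
... | yes _ with countDec-<⇒∃≮ (λ i → p (suc i)) (λ i → q (suc i)) (≤-pred count<k)
...   | u , qᵤ≮pᵤ = suc u , qᵤ≮pᵤ

Move⇒sumF-< : ∀ {j p q} → Move (suc j) p q → sumF q < sumF p
Move⇒sumF-< (inj₁ (q≤p , 1≤count , _)) = countDec-pos⇒sumF-< q≤p 1≤count
Move⇒sumF-< {j} {q = q} (inj₂ (t , 1≤t , p≡q+t)) =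
  subst (sumF q <_) (sym (sumF-shift q p≡q+t)) (m<m+n (sumF q) (≤-trans 1≤t (m≤m+n t (j * t))))

MoveI-intro : ∀ {k p q} u → (∀ i → q i ≤ p i) → q u ≡ p u → sumF q < sumF p → MoveI k p q
MoveI-intro {p = p} {q} u q≤p qᵤ≡pᵤ Σq<Σp =
    q≤p
  , (let i , qᵢ<pᵢ = sumF-<⇒∃< Σq<Σp in <⇒countDec-pos p q i qᵢ<pᵢ)
  , ≮⇒countDec-< p q u (λ qᵤ<pᵤ → <-irrefl qᵤ≡pᵤ qᵤ<pᵤ)

MoveI⇒untouched : ∀ {k p q} → MoveI k p q → ∃[ u ] q u ≡ p u
MoveI⇒untouched {p = p} {q} (q≤p , _ , count<k) =
  let u , qᵤ≮pᵤ = countDec-<⇒∃≮ p q count<k in u , ≤-antisym (q≤p u) (≮⇒≥ qᵤ≮pᵤ)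

IsP⇒¬IsN : ∀ {k p} → IsP k p → ¬ IsN k p
IsP⇒¬IsN (allMovesToN toN) (moveToP q p→q isP) = IsP⇒¬IsN isP (toN q p→q)

IsP⇔kernel : ∀ {j} (K : Position (suc j) → Set) →
             (∀ {p q} → K p → K q → ¬ Move (suc j) p q) →
             (∀ p → K p ⊎ ∃[ q ] Move (suc j) p q × K q) →
             ∀ p → IsP (suc j) p ⇔ K p
IsP⇔kernel {j} K stable absorbing p = mk⇔ IsP⇒K (λ Kp → K⇒IsP Kp (<-wellFounded (sumF p)))
  where
  K⇒IsP : ∀ {p} → K p → Acc _<_ (sumF p) → IsP (suc j) p
  K⇒IsP {p} Kp (acc smaller) = allMovesToN reply
    where
    reply : ∀ q → Move (suc j) p q → IsN (suc j) q
    reply q p→q with absorbing q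
    ... | inj₁ Kq              = ⊥-elim (stable Kp Kq p→q)
    ... | inj₂ (r , q→r , Kr) = moveToP r q→r (K⇒IsP Kr (smaller (<-trans (Move⇒sumF-< q→r) (Move⇒sumF-< p→q))))

  IsP⇒K : ∀ {p} → IsP (suc j) p → K p
  IsP⇒K {p} isP with absorbing p
  ... | inj₁ Kp              = Kp
  ... | inj₂ (q , p→q , Kq) = ⊥-elim (IsP⇒¬IsN isP (moveToP q p→q (K⇒IsP Kq (<-wellFounded (sumF q)))))

record Minimum {k} (p : Position k) (μ : ℕ) : Set where
  constructor minimum
  field
    attained : ∃[ i ] p i ≡ μ
    bound    : ∀ i → μ ≤ p i

open Minimum

minimum-exists : ∀ {k} (p : Position (suc k)) → ∃[ μ ] Minimum p μ
minimum-exists {zero}  p = p zero , minimum (zero , refl) (λ { zero → ≤-refl })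
minimum-exists {suc k} p with minimum-exists (λ i → p (suc i))
... | μ , minimum (i , pᵢ₊₁≡μ) μ≤p with p zero ≤? μ
...   | yes p₀≤μ = p zero , minimum (zero , refl) (λ { zero → ≤-refl ; (suc i) → ≤-trans p₀≤μ (μ≤p i) })
...   | no  p₀≰μ = μ , minimum (suc i , pᵢ₊₁≡μ) (λ { zero → <⇒≤ (≰⇒> p₀≰μ) ; (suc i) → μ≤p i })

Minimum-unique : ∀ {k} {p : Position k} {μ ν} → Minimum p μ → Minimum p ν → μ ≡ ν
Minimum-unique (minimum (i , pᵢ≡μ) μ≤p) (minimum (i′ , pᵢ′≡ν) ν≤p) =
  ≤-antisym (subst (_ ≤_) pᵢ′≡ν (μ≤p i′)) (subst (_ ≤_) pᵢ≡μ (ν≤p i))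

Minimum-raise : ∀ {k} {p q : Position k} {μ t} → (∀ i → p i ≡ q i + t) → Minimum q μ → Minimum p (μ + t)
Minimum-raise {μ = μ} {t} p≡q+t (minimum (i , qᵢ≡μ) μ≤q) =
  minimum (i , trans (p≡q+t i) (cong (_+ t) qᵢ≡μ))
          (λ i → subst (μ + t ≤_) (sym (p≡q+t i)) (+-monoˡ-≤ t (μ≤q i)))

Minimum-lower : ∀ {k} {p q : Position k} {μ t} → (∀ i → p i ≡ q i + t) → Minimum p (μ + t) → Minimum q μ
Minimum-lower {μ = μ} {t} p≡q+t (minimum (i , pᵢ≡μ+t) μ+t≤p) =
  minimum (i , +-cancelʳ-≡ t _ μ (trans (sym (p≡q+t i)) pᵢ≡μ+t))
          (λ i → +-cancelʳ-≤ t μ _ (subst (μ + t ≤_) (p≡q+t i) (μ+t≤p i)))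

record Pₙ (k n : ℕ) (p : Position k) : Set where
  constructor pₙ
  field
    minimal : Minimum p (T n)
    total   : sumF p ≡ k * T n + n

open Pₙ

𝒫 : ∀ k → Position k → Set
𝒫 k p = ∃[ n ] Pₙ k n p

level-split : ∀ j L n → suc j * L + n ≡ L + n + j * L
level-split = solve-∀

Pₙ-heap-≤ : ∀ {j n} {p : Position (suc j)} → Pₙ (suc j) n p → ∀ i → p i ≤ T n + n
Pₙ-heap-≤ {j} {n} {p} Pp i = +-cancelʳ-≤ (j * T n) (p i) (T n + n) (begin
  p i + j * T n        ≤⟨ sumF-lower-bound-at p (bound (minimal Pp)) i ⟩
  sumF p               ≡⟨ total Pp ⟩
  suc j * T n + n      ≡⟨ level-split j (T n) n ⟩
  T n + n + j * T n    ∎)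
  where open ≤-Reasoning

Pₙ-heap-< : ∀ {j n} {p : Position (suc j)} → Pₙ (suc j) n p → ∀ i → p i < T (suc n)
Pₙ-heap-< {n = n} {p} Pp i = begin-strict
  p i           ≤⟨ Pₙ-heap-≤ Pp i ⟩
  T n + n       <⟨ +-monoʳ-< (T n) (n<1+n n) ⟩
  T n + suc n   ≡⟨ T-suc n ⟨
  T (suc n)     ∎
  where open ≤-Reasoning

shift-total : ∀ k a t m → k * (a + t) + m ≡ k * a + m + k * t
shift-total = solve-∀

Pₙ-level-unique : ∀ {j n n′ u} {p q : Position (suc j)} → Pₙ (suc j) n p → Pₙ (suc j) n′ q → p u ≡ q u → n ≡ n′
Pₙ-level-unique {n′ = n′} {u} Pp Pq pᵤ≡qᵤ =
  T-floor-unique (bound (minimal Pp) u) (Pₙ-heap-< Pp u)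
                 (subst (T n′ ≤_) (sym pᵤ≡qᵤ) (bound (minimal Pq) u)) (subst (_< T (suc n′)) (sym pᵤ≡qᵤ) (Pₙ-heap-< Pq u))

Pₙ-stable : ∀ {j n n′} {p q : Position (suc j)} → Pₙ (suc j) n p → Pₙ (suc j) n′ q → ¬ Move (suc j) p q
Pₙ-stable {j} Pp Pq (inj₁ p→q) =
  let u , qᵤ≡pᵤ = MoveI⇒untouched p→q
      n≡n′      = Pₙ-level-unique Pp Pq (sym qᵤ≡pᵤ)
  in <-irrefl (trans (total Pq) (trans (cong (λ m → suc j * T m + m) (sym n≡n′)) (sym (total Pp))))
              (Move⇒sumF-< (inj₁ p→q))
Pₙ-stable {j} {n} {n′} {p} {q} Pp Pq (inj₂ (suc t , _ , p≡q+t)) = m+1+n≢m (T n′) (begin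
  T n′ + suc t   ≡⟨ Tn≡Tn′+t ⟨
  T n            ≡⟨ cong T n≡n′ ⟩
  T n′           ∎)
  where
  open ≡-Reasoning
  Tn≡Tn′+t : T n ≡ T n′ + suc t
  Tn≡Tn′+t = Minimum-unique (minimal Pp) (Minimum-raise p≡q+t (minimal Pq))
  n≡n′ : n ≡ n′
  n≡n′ = +-cancelˡ-≡ (suc j * T n) n n′ (begin
    suc j * T n + n                     ≡⟨ total Pp ⟨
    sumF p                              ≡⟨ sumF-shift q p≡q+t ⟩
    sumF q + suc j * suc t              ≡⟨ cong (_+ suc j * suc t) (total Pq) ⟩
    suc j * T n′ + n′ + suc j * suc t   ≡⟨ shift-total (suc j) (T n′) (suc t) n′ ⟨
    suc j * (T n′ + suc t) + n′         ≡⟨ cong (λ x → suc j * x + n′) Tn≡Tn′+t ⟨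
    suc j * T n + n′                    ∎)

shift-to-Pₙ : ∀ {k μ e} {p : Position k} → Minimum p μ → sumF p ≡ k * μ + e → T e < μ →
              ∃[ q ] Move k p q × Pₙ k e q
shift-to-Pₙ {k} {μ} {e} {p} min-p Σp≡kμ+e Te<μ =
  q , inj₂ (t , m<n⇒0<n∸m Te<μ , p≡q+t) , pₙ (Minimum-lower p≡q+t (subst (Minimum p) μ≡Te+t min-p)) Σq≡kTe+e
  where
  t = μ ∸ T e
  q : Position k
  q i = p i ∸ t
  p≡q+t : ∀ i → p i ≡ q i + t
  p≡q+t i = sym (m∸n+n≡m (≤-trans (m∸n≤m μ (T e)) (bound min-p i)))
  μ≡Te+t : μ ≡ T e + t
  μ≡Te+t = sym (m+[n∸m]≡n (<⇒≤ Te<μ))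
  Σq≡kTe+e : sumF q ≡ k * T e + e
  Σq≡kTe+e = +-cancelʳ-≡ (k * t) _ _ (begin
    sumF q + k * t      ≡⟨ sumF-shift q p≡q+t ⟨
    sumF p              ≡⟨ Σp≡kμ+e ⟩
    k * μ + e           ≡⟨ cong (λ x → k * x + e) μ≡Te+t ⟩
    k * (T e + t) + e   ≡⟨ shift-total k (T e) t e ⟩
    k * T e + e + k * t ∎)
    where open ≡-Reasoning

reduce-to-Pₙ : ∀ {j n} {p : Position (suc j)} u z → u ≢ z → (∀ i → T n ≤ p i) → p u ≤ T n + n →
               suc j * T n + n ≤ sumF (updateAt p z (const (T n))) → suc j * T n + n < sumF p →
               ∃[ q ] Move (suc j) p q × Pₙ (suc j) n q
reduce-to-Pₙ {j} {n} {p} u z u≢z Tn≤p pᵤ≤Tn+n S≤Σhi S<Σp with sumF-between lo hi lo≤hi Σlo≤S S≤Σhi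
  where
  lo hi : Position (suc j)
  lo = updateAt (const (T n)) u (const (p u))
  hi = updateAt p z (const (T n))
  lo≤hi : ∀ i → lo i ≤ hi i
  lo≤hi = updateAt-elim (λ i x → x ≤ hi i) (const (T n)) u (p u)
                        (≤-reflexive (sym (updateAt-minimal u z p u≢z))) (λ i _ → updateAt-≥ p z Tn≤p ≤-refl i)
  Σlo≤S : sumF lo ≤ suc j * T n + n
  Σlo≤S = +-cancelʳ-≤ (T n) _ _ (begin
    sumF lo + T n                     ≡⟨ sumF-updateAt (const (T n)) u (p u) ⟩
    sumF {suc j} (const (T n)) + p u  ≡⟨ cong (_+ p u) (sumF-const (suc j) (T n)) ⟩
    suc j * T n + p u                 ≤⟨ +-monoʳ-≤ (suc j * T n) pᵤ≤Tn+n ⟩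
    suc j * T n + (T n + n)           ≡⟨ cong (suc j * T n +_) (+-comm (T n) n) ⟩
    suc j * T n + (n + T n)           ≡⟨ +-assoc (suc j * T n) n (T n) ⟨
    suc j * T n + n + T n             ∎)
    where open ≤-Reasoning
... | q , lo≤q , q≤hi , Σq≡S =
  q , inj₁ (MoveI-intro u q≤p qᵤ≡pᵤ (subst (_< sumF p) (sym Σq≡S) S<Σp)) , pₙ (minimum (z , q_z≡Tn) Tn≤q) Σq≡S
  where
  q≤p : ∀ i → q i ≤ p i
  q≤p i = ≤-trans (q≤hi i) (updateAt-elim (λ i x → x ≤ p i) p z (T n) (Tn≤p z) (λ _ _ → ≤-refl) i)
  Tn≤q : ∀ i → T n ≤ q i
  Tn≤q i = ≤-trans (updateAt-≥ (const (T n)) u (λ _ → ≤-refl) (Tn≤p u) i) (lo≤q i)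
  qᵤ≡pᵤ : q u ≡ p u
  qᵤ≡pᵤ = ≤-antisym (q≤p u) (subst (_≤ q u) (updateAt-updates u (const (T n))) (lo≤q u))
  q_z≡Tn : q z ≡ T n
  q_z≡Tn = ≤-antisym (subst (q z ≤_) (updateAt-updates z p) (q≤hi z)) (Tn≤q z)

two-others : ∀ {j} → 2 ≤ j → (i : Fin (suc j)) → ∃[ z ] ∃[ r ] z ≢ i × r ≢ i × r ≢ z
two-others (s≤s (s≤s z≤n)) zero          = suc zero , suc (suc zero) , (λ ()) , (λ ()) , (λ ())
two-others (s≤s (s≤s z≤n)) (suc zero)    = zero , suc (suc zero) , (λ ()) , (λ ()) , (λ ())
two-others (s≤s (s≤s z≤n)) (suc (suc i)) = zero , suc zero , (λ ()) , (λ ()) , (λ ())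

reduce-to-floor-Pₙ : ∀ {j n μ e} {p : Position (suc j)} → 2 ≤ j → Minimum p μ → sumF p ≡ suc j * μ + e →
                     T n ≤ μ → μ < T (suc n) → n < e → ∃[ q ] Move (suc j) p q × Pₙ (suc j) n q
reduce-to-floor-Pₙ {j} {n} {μ} {e} {p} 2≤j min-p Σp≡ Tn≤μ μ<T[1+n] n<e =
  let i₀ , pᵢ₀≡μ              = attained min-p
      z , r , z≢i₀ , r≢i₀ , r≢z = two-others 2≤j i₀
  in case p r ≤? T n + n of λ where
    (yes pᵣ≤Tn+n) → reduce-to-Pₙ r i₀ r≢i₀ Tn≤p pᵣ≤Tn+n (lower-minimum pᵢ₀≡μ) S<Σp
    (no  pᵣ≰Tn+n) → reduce-to-Pₙ i₀ z (λ i₀≡z → z≢i₀ (sym i₀≡z)) Tn≤p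
                      (subst (_≤ T n + n) (sym pᵢ₀≡μ) μ≤Tn+n) (lower-other r≢z (≰⇒> pᵣ≰Tn+n)) S<Σp
  where
  open ≤-Reasoning
  S = suc j * T n + n
  Tn≤p : ∀ i → T n ≤ p i
  Tn≤p i = ≤-trans Tn≤μ (bound min-p i)
  μ≤Tn+n : μ ≤ T n + n
  μ≤Tn+n = ≤-pred (subst (μ <_) (trans (T-suc n) (+-suc (T n) n)) μ<T[1+n])
  S<Σp : S < sumF p
  S<Σp = subst (S <_) (sym Σp≡) (+-mono-≤-< (*-monoʳ-≤ (suc j) Tn≤μ) n<e)
  shuffle : ∀ j a b c → suc j * a + b + c ≡ j * a + b + (a + c)
  shuffle = solve-∀
  lower-minimum : ∀ {i₀} → p i₀ ≡ μ → S ≤ sumF (updateAt p i₀ (const (T n)))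
  lower-minimum {i₀} pᵢ₀≡μ = +-cancelʳ-≤ μ _ _ (begin
    suc j * T n + n + μ                          ≡⟨ shuffle j (T n) n μ ⟩
    j * T n + n + (T n + μ)                      ≤⟨ +-monoˡ-≤ (T n + μ) (+-mono-≤ (*-monoʳ-≤ j Tn≤μ) (<⇒≤ n<e)) ⟩
    j * μ + e + (T n + μ)                        ≡⟨ cong (j * μ + e +_) (+-comm (T n) μ) ⟩
    j * μ + e + (μ + T n)                        ≡⟨ shuffle j μ e (T n) ⟨
    suc j * μ + e + T n                          ≡⟨ cong (_+ T n) Σp≡ ⟨
    sumF p + T n                                 ≡⟨ sumF-updateAt p i₀ (T n) ⟨
    sumF (updateAt p i₀ (const (T n))) + p i₀    ≡⟨ cong (sumF (updateAt p i₀ (const (T n))) +_) pᵢ₀≡μ ⟩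
    sumF (updateAt p i₀ (const (T n))) + μ       ∎)
  lower-other : ∀ {z r} → r ≢ z → T n + n < p r → S ≤ sumF (updateAt p z (const (T n)))
  lower-other {z} {r} r≢z Tn+n<pᵣ = begin
    suc j * T n + n                              ≡⟨ level-split j (T n) n ⟩
    T n + n + j * T n                            ≤⟨ +-monoˡ-≤ (j * T n) (<⇒≤ Tn+n<pᵣ) ⟩
    p r + j * T n                                ≡⟨ cong (_+ j * T n) (updateAt-minimal r z p r≢z) ⟨
    updateAt p z (const (T n)) r + j * T n       ≤⟨ sumF-lower-bound-at _ (updateAt-≥ p z Tn≤p ≤-refl) r ⟩
    sumF (updateAt p z (const (T n)))            ∎

sumF-excess : ∀ {k μ} {p : Position k} → Minimum p μ → ∃[ e ] sumF p ≡ k * μ + e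
sumF-excess {k} {μ} {p} min-p = sumF p ∸ k * μ , sym (m+[n∸m]≡n (sumF-lower-bound p (bound min-p)))

𝒫-absorbing : ∀ {j} → 2 ≤ j → ∀ p → 𝒫 (suc j) p ⊎ ∃[ q ] Move (suc j) p q × 𝒫 (suc j) q
𝒫-absorbing {j} 2≤j p =
  let μ , min-p            = minimum-exists p
      e , Σp≡              = sumF-excess min-p
      n , Tn≤μ , μ<T[1+n] = T-floor μ
  in case T e <? μ of λ where
    (yes Te<μ) → inj₂ (at-level (shift-to-Pₙ {e = e} min-p Σp≡ Te<μ))
    (no  Te≮μ) → case m≤n⇒m<n∨m≡n (T-cancel-≤ {n} {e} (≤-trans Tn≤μ (≮⇒≥ Te≮μ))) of λ where
      (inj₁ n<e) → inj₂ (at-level (reduce-to-floor-Pₙ {n = n} 2≤j min-p Σp≡ Tn≤μ μ<T[1+n] n<e))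
      (inj₂ n≡e) → let μ≡Tn = ≤-antisym (subst (λ m → μ ≤ T m) (sym n≡e) (≮⇒≥ Te≮μ)) Tn≤μ in
        inj₁ (n , pₙ (subst (Minimum p) μ≡Tn min-p) (subst₂ (λ a b → sumF p ≡ suc j * a + b) μ≡Tn (sym n≡e) Σp≡))
  where
  at-level : ∀ {n} → ∃[ q ] Move (suc j) p q × Pₙ (suc j) n q → ∃[ q ] Move (suc j) p q × 𝒫 (suc j) q
  at-level (q , p→q , Pq) = q , p→q , _ , Pq

open MonoidSum +-0-commutativeMonoid using (sum; sum-permute)

sumF≡sum : ∀ {k} (f : Fin k → ℕ) → sumF f ≡ sum f
sumF≡sum {zero}  f = refl
sumF≡sum {suc k} f = cong (f zero +_) (sumF≡sum (λ i → f (suc i)))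

sumF-permute : ∀ {k} (f : Fin k → ℕ) (σ : Permutation′ k) → sumF f ≡ sumF (λ i → f (σ ⟨$⟩ʳ i))
sumF-permute f σ = trans (sumF≡sum f) (trans (sum-permute f σ) (sym (sumF≡sum (λ i → f (σ ⟨$⟩ʳ i)))))

sorting-permutation : ∀ {k} (p : Fin k → ℕ) → Σ[ σ ∈ Permutation′ k ] Sorted (λ i → p (σ ⟨$⟩ʳ i))
sorting-permutation {zero}  p = Perm.id , λ ()
sorting-permutation {suc k} p with minimum-exists p
... | μ , minimum (i , pᵢ≡μ) μ≤p with sorting-permutation (λ x → p (transpose zero i ⟨$⟩ʳ suc x))
...   | ρ , sorted = lift₀ ρ ∘ₚ transpose zero i , sorted′
  where
  sorted′ : Sorted (λ x → p ((lift₀ ρ ∘ₚ transpose zero i) ⟨$⟩ʳ x))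
  sorted′ zero    y       _         = subst (_≤ _) (sym pᵢ≡μ) (μ≤p _)
  sorted′ (suc x) (suc y) (s≤s x≤y) = sorted x y x≤y

𝒫⇔InP : ∀ j (p : Position (suc j)) → 𝒫 (suc j) p ⇔ InP j p
𝒫⇔InP j p = mk⇔ to from
  where
  to : 𝒫 (suc j) p → InP j p
  to (n , pₙ (minimum (a , pₐ≡Tn) Tn≤p) Σp≡) with sorting-permutation p
  ... | σ , sorted = σ , sorted , n , pσ₀≡Tn , Σtail≡ , (λ i → Tn≤p _) , (λ i i′ i≤i′ → sorted (suc i) (suc i′) (s≤s i≤i′))
    where
    pσ₀≡Tn : p (σ ⟨$⟩ʳ zero) ≡ T n
    pσ₀≡Tn = ≤-antisym (≤-trans (sorted zero (σ ⟨$⟩ˡ a) z≤n) (≤-reflexive (trans (cong p (Perm.inverseʳ σ)) pₐ≡Tn)))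
                       (Tn≤p _)
    Σtail≡ : sumF (λ i → p (σ ⟨$⟩ʳ suc i)) ≡ j * T n + n
    Σtail≡ = +-cancelˡ-≡ (T n) _ _ (begin
      T n + sumF (λ i → p (σ ⟨$⟩ʳ suc i))                ≡⟨ cong (_+ sumF (λ i → p (σ ⟨$⟩ʳ suc i))) pσ₀≡Tn ⟨
      sumF (λ i → p (σ ⟨$⟩ʳ i))                          ≡⟨ sumF-permute p σ ⟨
      sumF p                                             ≡⟨ Σp≡ ⟩
      T n + j * T n + n                                  ≡⟨ +-assoc (T n) (j * T n) n ⟩
      T n + (j * T n + n)                                ∎)
      where open ≡-Reasoning

  from : InP j p → 𝒫 (suc j) p
  from (σ , _ , n , pσ₀≡Tn , Σtail≡ , Tn≤tail , _) =
    n , pₙ (minimum (σ ⟨$⟩ʳ zero , pσ₀≡Tn) Tn≤p) Σp≡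
    where
    Tn≤pσ : ∀ i → T n ≤ p (σ ⟨$⟩ʳ i)
    Tn≤pσ zero    = ≤-reflexive (sym pσ₀≡Tn)
    Tn≤pσ (suc i) = Tn≤tail i
    Tn≤p : ∀ i → T n ≤ p i
    Tn≤p i = subst (λ x → T n ≤ p x) (Perm.inverseʳ σ) (Tn≤pσ (σ ⟨$⟩ˡ i))
    Σp≡ : sumF p ≡ suc j * T n + n
    Σp≡ = begin
      sumF p                            ≡⟨ sumF-permute p σ ⟩
      sumF (λ i → p (σ ⟨$⟩ʳ i))        ≡⟨ cong₂ _+_ pσ₀≡Tn Σtail≡ ⟩
      T n + (j * T n + n)               ≡⟨ +-assoc (T n) (j * T n) n ⟨
      suc j * T n + n                   ∎
      where open ≡-Reasoning

theorem1 : (j : ℕ) → 2 ≤ j → (p : Position (suc j)) → IsP (suc j) p ⇔ InP j p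
theorem1 j 2≤j p =
  𝒫⇔InP j p ⇔-∘ IsP⇔kernel (𝒫 (suc j)) (λ (_ , Pp) (_ , Pq) → Pₙ-stable Pp Pq) (𝒫-absorbing 2≤j) p
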